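{- If a $\mathbb{Z}$-labelled graph $(\hat G,z)$ has no minor isomorphic to $(K_4,0)$ nor to $(K_3^{\bullet\bullet},w)$ for any simple labelling $w$, then the simple graph $\mathrm{si}(\hat G)$ does not have $K_4$ as a minor.
   Context: A $\mathbb{Z}$-labelled graph $(\hat G,z)$ is a finite directed multigraph $\hat G=(\hat V,\hat E)$ (selfloops allowed) with a simple labelling $z:\hat E\to\mathbb{Z}$ (selfloops have nonzero labels; no two parallel edges with the same direction and label, nor opposite directions and opposite labels); an edge from $i$ to $j$ with label $\gamma$ is $(i,j;\gamma)$. $\mathrm{si}(\hat G)$ is the simple loopless undirected graph obtained from $\hat G$ by removing selfloops and forgetting directions and multiplicities; minors of $\mathrm{si}(\hat G)$ are ordinary graph minors. Minor operations on $\mathbb{Z}$-labelled graphs: edge inversion (reverse an edge, negate its label); switching at vertex $i$ by $\gamma$ (each non-loop edge $(i,j;\alpha)$ becomes $(i,j;\alpha+\gamma)$, each non-loop edge $(j,i;\alpha)$ becomes $(j,i;\alpha-\gamma)$). Two $\mathbb{Z}$-labelled graphs are isomorphic if after edge inversions and switchings there is a vertex bijection mapping labelled directed edges exactly onto labelled directed edges. Deletion removes an edge or vertex (with incident edges), restricting labels. Contraction of a non-loop edge $e=(i,j;0)$ identifies $i,j$, removes $e$, and deletes selfloops of label $0$ and redundant parallel edges so the labelling stays simple. A minor is, up to isomorphism, the result of a sequence of deletions and contractions. $(K_4,0)$ is the simple complete graph on $4$ vertices (edges oriented arbitrarily) with all labels $0$. $K_3^{\bullet\bullet}$ is the directed multigraph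 on $\{1,2,3\}$ with a single edge from $1$ to $2$, two parallel edges between $1$ and $3$, and two parallel edges between $2$ and $3$. -}

module Defs where

open import Level using (Level; _⊔_)
open import Data.Nat using (ℕ; zero; suc)
open import Data.Fin using (Fin; zero; suc; punchOut; _≟_)
open import Data.Integer using (ℤ; +_; -_; _+_; _-_) renaming (_≟_ to _≟ℤ_)
open import Data.Integer.Properties using (neg-involutive)
open import Data.Product using (_×_; _,_; ∃; ∃-syntax; Σ)
open import Data.Product.Properties using (≡-dec)
open import Data.Sum using (_⊎_; inj₁; inj₂)
open import Data.Sum.Relation.Unary.All using () 
open import Data.List using (List; []; _∷_)
open import Data.List.Relation.Unary.Any as Any using (Any)
open import Data.List.Relation.Unary.All using (All; []; _∷_)
open import Data.List.Relation.Unary.AllPairs using (AllPairs; allPairs?)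
open import Relation.Nullary using (¬_; Dec; yes; no)
open import Relation.Nullary.Decidable using (toWitness; _⊎-dec_; ¬?)
open import Relation.Binary.PropositionalEquality using (_≡_; _≢_; refl; sym; cong; trans)
open import Relation.Binary.Construct.Closure.ReflexiveTransitive using (Star)
open import Function.Bundles using (_↔_; Inverse)
open import Function.Definitions using (Injective)

_⟺_ : ∀ {a b : Level} → Set a → Set b → Set (a ⊔ b)
P ⟺ Q = (P → Q) × (Q → P)

-- Z-labelled graphs
-- An edge (i , j , γ) : from i to j with label γ.

Edge : ℕ → Set
Edge n = Fin n × Fin n × ℤ

inv : ∀ {n} → Edge n → Edge n
inv (a , b , γ) = (b , a , - γ)

-- equal up to inversion (edges are considered up to inversion)
_≈ₑ_ : ∀ {n} → Edge n → Edge n → Set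
e ≈ₑ f = e ≡ f ⊎ e ≡ inv f

_∈ᴱ_ : ∀ {n} → Edge n → List (Edge n) → Set
e ∈ᴱ E = Any (e ≈ₑ_) E

mapV : ∀ {m n} → (Fin m → Fin n) → Edge m → Edge n
mapV f (a , b , γ) = (f a , f b , γ)

NonzeroLoop : ∀ {n} → Edge n → Set
NonzeroLoop (a , b , γ) = a ≡ b → γ ≢ + 0

IsZeroLoop : ∀ {n} → Edge n → Set
IsZeroLoop (a , b , γ) = a ≡ b × γ ≡ + 0

SimpleLab : ∀ {n} → List (Edge n) → Set
SimpleLab E = All NonzeroLoop E × AllPairs (λ e f → ¬ (e ≈ₑ f)) E

record ZGraph : Set where
  constructor zg
  field
    n      : ℕ
    edges  : List (Edge n)
    simple : SimpleLab edges
open ZGraph public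

-- combined switching (vertex i switched by s i) followed by vertex bijection π
switchMap : ∀ {m n} → (Fin m → Fin n) → (Fin m → ℤ) → Edge m → Edge n
switchMap π s (a , b , α) = (π a , π b , α + s a - s b)

-- the vertex map of contracting (u,v): v is identified with u, then the
-- vertex set Fin (suc m) ∖ {v} is renumbered as Fin m
cmap : ∀ {m} (u v : Fin (suc m)) → u ≢ v → Fin (suc m) → Fin m
cmap u v u≢v x with v ≟ x
... | yes _   = punchOut {i = v} {j = u} (λ eq → u≢v (sym eq))
... | no v≢x  = punchOut v≢x

ContractEdge : ∀ {m} (u v : Fin (suc m)) → u ≢ v → List (Edge (suc m)) → Edge m → Set
ContractEdge u v u≢v E f =
  ¬ IsZeroLoop f × ∃[ e ] (e ∈ᴱ E × ¬ (e ≈ₑ (u , v , + 0)) × mapV (cmap u v u≢v) e ≡ f)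

data ZStep : ZGraph → ZGraph → Set where
  -- edge inversions, switchings and vertex relabelling (isomorphism)
  iso : ∀ {G H} (π : Fin (n G) ↔ Fin (n H)) (s : Fin (n G) → ℤ) →
        (∀ e → (e ∈ᴱ edges G) ⟺ (switchMap (Inverse.to π) s e ∈ᴱ edges H)) →
        ZStep G H
  -- deletions of vertices and edges (H is, up to relabelling, a subgraph of G)
  sub : ∀ {G H} (ι : Fin (n H) → Fin (n G)) → Injective _≡_ _≡_ ι →
        (∀ f → f ∈ᴱ edges H → mapV ι f ∈ᴱ edges G) →
        ZStep G H
  contract : ∀ {m} {E : List (Edge (suc m))} {sE} {F : List (Edge m)} {sF}
             (u v : Fin (suc m)) (u≢v : u ≢ v) → (u , v , + 0) ∈ᴱ E →
             (∀ f → (f ∈ᴱ F) ⟺ ContractEdge u v u≢v E f) →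
             ZStep (zg (suc m) E sE) (zg m F sF)

ZMinor : ZGraph → ZGraph → Set
ZMinor = Star ZStep

private
  edge? : ∀ {n} (e f : Edge n) → Dec (e ≡ f)
  edge? = ≡-dec _≟_ (≡-dec _≟_ _≟ℤ_)

  ≈ₑ? : ∀ {n} (e f : Edge n) → Dec (e ≈ₑ f)
  ≈ₑ? e f = edge? e f ⊎-dec edge? e (inv f)

f0 f1 f2 f3 : Fin 4
f0 = zero
f1 = suc zero
f2 = suc (suc zero)
f3 = suc (suc (suc zero))

K4edges : List (Edge 4)
K4edges = (f0 , f1 , + 0) ∷ (f0 , f2 , + 0) ∷ (f0 , f3 , + 0)
        ∷ (f1 , f2 , + 0) ∷ (f1 , f3 , + 0) ∷ (f2 , f3 , + 0) ∷ []

K4simple : SimpleLab K4edges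
K4simple = ((λ ()) ∷ (λ ()) ∷ (λ ()) ∷ (λ ()) ∷ (λ ()) ∷ (λ ()) ∷ [])
         , toWitness {a? = allPairs? (λ e f → ¬? (≈ₑ? e f)) K4edges} _

K4₀ : ZGraph
K4₀ = zg 4 K4edges K4simple

-- K₃^{••} with labels a (1→2), b, c (1→3), d, e (2→3); vertices 1,2,3 are 0,1,2
K3••edges : ℤ → ℤ → ℤ → ℤ → ℤ → List (Edge 3)
K3••edges a b c d e =
  (zero , suc zero , a) ∷ (zero , suc (suc zero) , b) ∷ (zero , suc (suc zero) , c)
  ∷ (suc zero , suc (suc zero) , d) ∷ (suc zero , suc (suc zero) , e) ∷ []

record SGraph : Set₁ where
  constructor sg
  field
    size    : ℕ
    Adj     : Fin size → Fin size → Set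
    adj-sym : ∀ {a b} → Adj a b → Adj b a
    adj-irr : ∀ {a} → ¬ Adj a a
open SGraph public

data SStep : SGraph → SGraph → Set₁ where
  iso : ∀ {G H} (π : Fin (size G) ↔ Fin (size H)) →
        (∀ a b → Adj G a b ⟺ Adj H (Inverse.to π a) (Inverse.to π b)) →
        SStep G H
  sub : ∀ {G H} (ι : Fin (size H) → Fin (size G)) → Injective _≡_ _≡_ ι →
        (∀ a b → Adj H a b → Adj G (ι a) (ι b)) →
        SStep G H
  contract : ∀ {m} {A : Fin (suc m) → Fin (suc m) → Set}
             {sA : ∀ {a b} → A a b → A b a} {iA : ∀ {a} → ¬ A a a}
             {B : Fin m → Fin m → Set}
             {sB : ∀ {a b} → B a b → B b a} {iB : ∀ {a} → ¬ B a a}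
             (u v : Fin (suc m)) (u≢v : u ≢ v) → A u v →
             (∀ a b → B a b ⟺ (a ≢ b × ∃[ x ] ∃[ y ]
                (cmap u v u≢v x ≡ a × cmap u v u≢v y ≡ b × A x y))) →
             SStep (sg (suc m) A sA iA) (sg m B sB iB)

SMinor : SGraph → SGraph → Set₁
SMinor = Star SStep

private
  inv-inv : ∀ {n} (e : Edge n) → inv (inv e) ≡ e
  inv-inv (a , b , γ) = cong (λ x → (a , b , x)) (neg-involutive γ)

  inv-≈ : ∀ {n} {e f : Edge n} → e ≈ₑ f → inv e ≈ₑ f
  inv-≈ {f = f} (inj₁ refl) = inj₂ refl
  inv-≈ {f = f} (inj₂ refl) = inj₁ (inv-inv f)

  si-sym : ∀ (G : ZGraph) {a b : Fin (n G)} →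
           (a ≢ b × ∃[ γ ] ((a , b , γ) ∈ᴱ edges G)) →
           (b ≢ a × ∃[ γ ] ((b , a , γ) ∈ᴱ edges G))
  si-sym G (a≢b , γ , m) = (λ eq → a≢b (sym eq)) , - γ , Any.map inv-≈ m

-- si(Ĝ): remove selfloops, forget directions, labels and multiplicities
si : ZGraph → SGraph
si G = sg (n G) (λ a b → a ≢ b × ∃[ γ ] ((a , b , γ) ∈ᴱ edges G))
          (si-sym G) (λ p → Data.Product.proj₁ p refl)
  where import Data.Product

K4 : SGraph
K4 = sg 4 (λ a b → a ≢ b) (λ p q → p (sym q)) (λ p → p refl)

{-# OPTIONS --safe #-}

-- Every step of an ordinary minor sequence of si(Ĝ) lifts to ℤ-labelled minor operations:
-- deletions lift directly, and contracting an edge uv lifts to switching v so that an edge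
-- from u to v gets label 0, then contracting that edge.  So a K₄ minor of si(Ĝ) yields a
-- minor H of Ĝ with four corners joined pairwise by edges with skew labels ℓ.  Call a
-- triangle balanced when ℓ sums to 0 around it.  If the three triangles through one corner
-- are balanced, switching by ℓ(0, ·) zeroes every label, giving (K₄, 0).  Otherwise the
-- cocycle relation among the four triangle sums makes two triangles unbalanced; they share
-- a side, and contracting it leaves a triangle with two doubled sides, a K₃••.

module Submission where

open import Defs
open import Level using (0ℓ)
open import Data.Nat using (ℕ; zero; suc)
open import Data.Fin using (Fin; punchIn; punchOut; _≟_; _<_)
open import Data.Fin.Patterns using (0F; 1F; 2F; 3F)
open import Data.Fin.Permutation using (Permutation′; _⟨$⟩ʳ_; _∘ₚ_; transpose)
import Data.Fin.Permutation as Perm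
open import Data.Fin.Properties
  using ( <-cmp; <-irrelevant; <⇒≢; punchOut-cong; punchOut-injective; punchIn-punchOut
        ; punchIn-injective; punchInᵢ≢i)
open import Data.Empty using (⊥-elim)
open import Data.Integer using (ℤ; +_; -_; _+_; _-_) renaming (_≟_ to _≟ℤ_)
open import Data.Integer.Properties using (neg-involutive; +-comm; +-inverseʳ)
open import Data.Integer.Tactic.RingSolver using (solve-∀)
open import Data.Product using (_×_; _,_; ∃-syntax; Σ-syntax; proj₁; proj₂)
open import Data.Product.Properties using (≡-dec)
open import Data.Sum using (_⊎_; inj₁; inj₂)
open import Data.List using (List; []; _∷_; map; filter; deduplicate)
open import Data.List.Relation.Unary.Any using (here; there)
open import Data.List.Relation.Unary.All using (All; []; _∷_)
import Data.List.Relation.Unary.All as All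
import Data.List.Relation.Unary.All.Properties as All
open import Data.List.Relation.Unary.AllPairs using ([]; _∷_)
import Data.List.Relation.Unary.AllPairs as AllPairs
import Data.List.Relation.Unary.AllPairs.Properties as AllPairs
open import Data.List.Membership.Setoid.Properties
  using (∈-resp-≈; ∈-map⁺; ∈-map⁻; ∈-filter⁺; ∈-filter⁻; ∈-deduplicate⁺; ∈-deduplicate⁻)
open import Data.List.Relation.Unary.Unique.DecSetoid.Properties using (deduplicate-!)
open import Relation.Nullary using (¬_; Dec; yes; no)
open import Relation.Nullary.Decidable using (_⊎-dec_; _×-dec_; ¬?; toWitness; toWitnessFalse; False)
open import Relation.Binary using (Setoid; DecSetoid; tri<; tri≈; tri>)
open import Relation.Binary.PropositionalEquality
  using (_≡_; _≢_; refl; sym; trans; cong; cong₂; subst; subst₂; module ≡-Reasoning)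
open ≡-Reasoning
open import Relation.Binary.Construct.Closure.ReflexiveTransitive using (ε; _◅_; _◅◅_)
open import Function using (_∘_; id)
open import Function.Definitions using (Injective)
open import Function.Construct.Identity using (↔-id)
open import Function.Bundles using (Inverse; Injection)
open import Function.Properties.Inverse using (↔-sym; ↔⇒↣)

inv-involutive : ∀ {n} (e : Edge n) → inv (inv e) ≡ e
inv-involutive (a , b , γ) = cong (λ γ′ → a , b , γ′) (neg-involutive γ)

≈ₑ-refl : ∀ {n} {e : Edge n} → e ≈ₑ e
≈ₑ-refl = inj₁ refl

≈ₑ-sym : ∀ {n} {e f : Edge n} → e ≈ₑ f → f ≈ₑ e
≈ₑ-sym (inj₁ refl) = inj₁ refl
≈ₑ-sym {f = f} (inj₂ refl) = inj₂ (sym (inv-involutive f))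

≈ₑ-trans : ∀ {n} {e f g : Edge n} → e ≈ₑ f → f ≈ₑ g → e ≈ₑ g
≈ₑ-trans (inj₁ refl) f≈g = f≈g
≈ₑ-trans (inj₂ refl) (inj₁ refl) = inj₂ refl
≈ₑ-trans (inj₂ refl) (inj₂ refl) = inj₁ (inv-involutive _)

_≟ₑ_ : ∀ {n} (e f : Edge n) → Dec (e ≡ f)
_≟ₑ_ = ≡-dec _≟_ (≡-dec _≟_ _≟ℤ_)

_≈ₑ?_ : ∀ {n} (e f : Edge n) → Dec (e ≈ₑ f)
e ≈ₑ? f = (e ≟ₑ f) ⊎-dec (e ≟ₑ inv f)

edgeDecSetoid : ℕ → DecSetoid 0ℓ 0ℓ
edgeDecSetoid n = record
  { Carrier = Edge n
  ; _≈_ = _≈ₑ_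
  ; isDecEquivalence = record
    { isEquivalence = record { refl = ≈ₑ-refl ; sym = ≈ₑ-sym ; trans = ≈ₑ-trans }
    ; _≟_ = _≈ₑ?_
    }
  }

edgeSetoid : ℕ → Setoid 0ℓ 0ℓ
edgeSetoid n = DecSetoid.setoid (edgeDecSetoid n)

inv-≈ₑ : ∀ {n} (e : Edge n) → inv e ≈ₑ e
inv-≈ₑ e = inj₂ refl

∈ᴱ-resp-≈ₑ : ∀ {n} {e f : Edge n} {E} → e ≈ₑ f → f ∈ᴱ E → e ∈ᴱ E
∈ᴱ-resp-≈ₑ e≈f = ∈-resp-≈ (edgeSetoid _) (≈ₑ-sym e≈f)

∈ᴱ-inv : ∀ {n} {e : Edge n} {E} → e ∈ᴱ E → inv e ∈ᴱ E
∈ᴱ-inv {e = e} = ∈ᴱ-resp-≈ₑ (inv-≈ₑ e)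

mapV-inv : ∀ {m n} (f : Fin m → Fin n) (e : Edge m) → mapV f (inv e) ≡ inv (mapV f e)
mapV-inv f (a , b , γ) = refl

mapV-≈ₑ : ∀ {m n} (f : Fin m → Fin n) {e e′ : Edge m} → e ≈ₑ e′ → mapV f e ≈ₑ mapV f e′
mapV-≈ₑ f (inj₁ refl) = inj₁ refl
mapV-≈ₑ f {e′ = e′} (inj₂ refl) = inj₂ (mapV-inv f e′)

deletion : ∀ (G H : ZGraph) (ι : Fin (n H) → Fin (n G)) → Injective _≡_ _≡_ ι →
           All (λ f → mapV ι f ∈ᴱ edges G) (edges H) → ZStep G H
deletion G H ι ι-injective ι[H]⊆G =
  sub ι ι-injective λ f → All.lookupₛ (edgeSetoid _) resp ι[H]⊆G
  where
  resp : ∀ {f f′} → f ≈ₑ f′ → mapV ι f ∈ᴱ edges G → mapV ι f′ ∈ᴱ edges G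
  resp f≈f′ = ∈ᴱ-resp-≈ₑ (mapV-≈ₑ ι (≈ₑ-sym f≈f′))

switch : ∀ {n} → (Fin n → ℤ) → Edge n → Edge n
switch s (a , b , α) = (a , b , α + s a - s b)

switch-inv : ∀ {n} (s : Fin n → ℤ) (e : Edge n) → switch s (inv e) ≡ inv (switch s e)
switch-inv s (a , b , α) = cong (λ γ → b , a , γ) (lemma α (s a) (s b))
  where
  lemma : ∀ α x y → - α + y - x ≡ - (α + x - y)
  lemma = solve-∀

switch-≈ₑ : ∀ {n} (s : Fin n → ℤ) {e f : Edge n} → e ≈ₑ f → switch s e ≈ₑ switch s f
switch-≈ₑ s (inj₁ refl) = inj₁ refl
switch-≈ₑ s {f = f} (inj₂ refl) = inj₂ (switch-inv s f)

switch-neg : ∀ {n} (s : Fin n → ℤ) (e : Edge n) → switch (-_ ∘ s) (switch s e) ≡ e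
switch-neg s (a , b , α) = cong (λ γ → a , b , γ) (lemma α (s a) (s b))
  where
  lemma : ∀ α x y → α + x - y + - x - - y ≡ α
  lemma = solve-∀

switch-reflects-≈ₑ : ∀ {n} (s : Fin n → ℤ) {e f : Edge n} → switch s e ≈ₑ switch s f → e ≈ₑ f
switch-reflects-≈ₑ s {e} {f} =
  subst₂ _≈ₑ_ (switch-neg s e) (switch-neg s f) ∘ switch-≈ₑ (-_ ∘ s)

switch-NonzeroLoop : ∀ {n} (s : Fin n → ℤ) {e : Edge n} → NonzeroLoop e → NonzeroLoop (switch s e)
switch-NonzeroLoop s {a , b , α} α≢0 refl α′≡0 = α≢0 refl (trans (sym (lemma α (s a))) α′≡0)
  where
  lemma : ∀ α x → α + x - x ≡ α
  lemma = solve-∀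

switched : (G : ZGraph) → (Fin (n G) → ℤ) → ZGraph
switched G s = zg (n G) (map (switch s) (edges G))
  ( All.map⁺ (All.map (switch-NonzeroLoop s) (proj₁ (simple G)))
  , AllPairs.map⁺ (AllPairs.map (λ e≉f → e≉f ∘ switch-reflects-≈ₑ s) (proj₂ (simple G))))

∈ᴱ-switched⁺ : ∀ {n} (s : Fin n → ℤ) {e : Edge n} {E} → e ∈ᴱ E → switch s e ∈ᴱ map (switch s) E
∈ᴱ-switched⁺ s = ∈-map⁺ (edgeSetoid _) (edgeSetoid _) (switch-≈ₑ s)

∈ᴱ-switched⁻ : ∀ {n} (s : Fin n → ℤ) {e : Edge n} {E} → switch s e ∈ᴱ map (switch s) E → e ∈ᴱ E
∈ᴱ-switched⁻ s se∈ =
  let f , f∈E , se≈sf = ∈-map⁻ (edgeSetoid _) (edgeSetoid _) se∈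
  in ∈ᴱ-resp-≈ₑ (switch-reflects-≈ₑ s se≈sf) f∈E

switching : (G : ZGraph) (s : Fin (n G) → ℤ) → ZStep G (switched G s)
switching G s = iso (↔-id _) s λ e → ∈ᴱ-switched⁺ s , ∈ᴱ-switched⁻ s

mapV-preimage : ∀ {m n} (ι : Fin m → Fin n) {f : Edge n} {g : Edge m} →
                f ≈ₑ mapV ι g → ∃[ g′ ] (g′ ≈ₑ g × mapV ι g′ ≡ f)
mapV-preimage ι {g = g} (inj₁ f≡ιg) = g , ≈ₑ-refl , sym f≡ιg
mapV-preimage ι {g = g} (inj₂ f≡ιg⁻¹) = inv g , inv-≈ₑ g , trans (mapV-inv ι g) (sym f≡ιg⁻¹)

isZeroLoop? : ∀ {n} (e : Edge n) → Dec (IsZeroLoop e)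
isZeroLoop? (a , b , γ) = (a ≟ b) ×-dec (γ ≟ℤ + 0)

IsZeroLoop-resp : ∀ {n} {e f : Edge n} → e ≈ₑ f → IsZeroLoop e → IsZeroLoop f
IsZeroLoop-resp (inj₁ refl) z = z
IsZeroLoop-resp {f = c , d , δ} (inj₂ refl) (refl , -δ≡0) =
  refl , trans (sym (neg-involutive δ)) (cong -_ -δ≡0)

module _ {m : ℕ} (u v : Fin (suc m)) (u≢v : u ≢ v) where

  private
    c : Fin (suc m) → Fin m
    c = cmap u v u≢v

    uv₀ : Edge (suc m)
    uv₀ = (u , v , + 0)

    ¬≈uv₀-resp : ∀ {e f} → e ≈ₑ f → ¬ (e ≈ₑ uv₀) → ¬ (f ≈ₑ uv₀)
    ¬≈uv₀-resp e≈f e≉uv₀ = e≉uv₀ ∘ ≈ₑ-trans e≈f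

    ¬IsZeroLoop-resp : ∀ {e f : Edge m} → e ≈ₑ f → ¬ IsZeroLoop e → ¬ IsZeroLoop f
    ¬IsZeroLoop-resp e≈f nz = nz ∘ IsZeroLoop-resp (≈ₑ-sym e≈f)

    ≈ₑ-resp-flip : ∀ {e f g : Edge m} → g ≈ₑ f → e ≈ₑ f → e ≈ₑ g
    ≈ₑ-resp-flip g≈f e≈f = ≈ₑ-trans e≈f (≈ₑ-sym g≈f)

    images : List (Edge (suc m)) → List (Edge m)
    images E = map (mapV c) (filter (λ e → ¬? (e ≈ₑ? uv₀)) E)

    kept : List (Edge (suc m)) → List (Edge m)
    kept E = filter (¬? ∘ isZeroLoop?) (images E)

  contractedEdges : List (Edge (suc m)) → List (Edge m)
  contractedEdges E = deduplicate _≈ₑ?_ (kept E)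

  contractedEdges-simple : ∀ E → SimpleLab (contractedEdges E)
  contractedEdges-simple E =
    All.deduplicate⁺ _≈ₑ?_ (All.map nonzero (All.all-filter (¬? ∘ isZeroLoop?) (images E)))
    , deduplicate-! (edgeDecSetoid m) (kept E)
    where
    nonzero : ∀ {f : Edge m} → ¬ IsZeroLoop f → NonzeroLoop f
    nonzero {a , b , γ} nz a≡b γ≡0 = nz (a≡b , γ≡0)

  ∈ᴱ-contractedEdges⁺ : ∀ E {f} → ContractEdge u v u≢v E f → f ∈ᴱ contractedEdges E
  ∈ᴱ-contractedEdges⁺ E (nz , e , e∈E , e≉uv₀ , refl) =
    ∈-deduplicate⁺ (edgeSetoid m) _≈ₑ?_ ≈ₑ-resp-flip
      (∈-filter⁺ (edgeSetoid m) (¬? ∘ isZeroLoop?) ¬IsZeroLoop-resp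
        (∈-map⁺ (edgeSetoid _) (edgeSetoid m) (mapV-≈ₑ c)
          (∈-filter⁺ (edgeSetoid _) (λ e → ¬? (e ≈ₑ? uv₀)) ¬≈uv₀-resp e∈E e≉uv₀))
        nz)

  ∈ᴱ-contractedEdges⁻ : ∀ E {f} → f ∈ᴱ contractedEdges E → ContractEdge u v u≢v E f
  ∈ᴱ-contractedEdges⁻ E f∈F =
    let f∈map , nz = ∈-filter⁻ (edgeSetoid m) (¬? ∘ isZeroLoop?) ¬IsZeroLoop-resp
                       (∈-deduplicate⁻ (edgeSetoid m) _≈ₑ?_ (kept E) f∈F)
        g , g∈filter , f≈cg = ∈-map⁻ (edgeSetoid _) (edgeSetoid m) f∈map
        g∈E , g≉uv₀ = ∈-filter⁻ (edgeSetoid _) (λ e → ¬? (e ≈ₑ? uv₀)) ¬≈uv₀-resp g∈filter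
        g′ , g′≈g , cg′≡f = mapV-preimage c f≈cg
    in nz , g′ , ∈ᴱ-resp-≈ₑ g′≈g g∈E , ¬≈uv₀-resp (≈ₑ-sym g′≈g) g≉uv₀ , cg′≡f

  contracted : List (Edge (suc m)) → ZGraph
  contracted E = zg m (contractedEdges E) (contractedEdges-simple E)

  contraction : ∀ {E sE} → uv₀ ∈ᴱ E → ZStep (zg (suc m) E sE) (contracted E)
  contraction {E} uv₀∈E = contract u v u≢v uv₀∈E λ f →
    ∈ᴱ-contractedEdges⁻ E , ∈ᴱ-contractedEdges⁺ E

cmap-punchOut : ∀ {m} (u v : Fin (suc m)) (u≢v : u ≢ v) {x} (v≢x : v ≢ x) →
                cmap u v u≢v x ≡ punchOut v≢x
cmap-punchOut u v u≢v {x} v≢x with v ≟ x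
... | yes v≡x = ⊥-elim (v≢x v≡x)
... | no _ = punchOut-cong v refl

cmap-identifies : ∀ {m} (u v : Fin (suc m)) (u≢v : u ≢ v) → cmap u v u≢v u ≡ cmap u v u≢v v
cmap-identifies u v u≢v with v ≟ v
... | no v≢v = ⊥-elim (v≢v refl)
... | yes _ = trans (cmap-punchOut u v u≢v (u≢v ∘ sym)) (punchOut-cong v refl)

cmap-injective : ∀ {m} (u v : Fin (suc m)) (u≢v : u ≢ v) {x y} → v ≢ x → v ≢ y →
                 cmap u v u≢v x ≡ cmap u v u≢v y → x ≡ y
cmap-injective u v u≢v v≢x v≢y cx≡cy = punchOut-injective v≢x v≢y
  (trans (sym (cmap-punchOut u v u≢v v≢x)) (trans cx≡cy (cmap-punchOut u v u≢v v≢y)))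

cmap-natural : ∀ {m k} (φ : Fin (suc m) → Fin (suc k)) (u v : Fin (suc m))
               (u≢v : u ≢ v) (φu≢φv : φ u ≢ φ v) x →
               cmap (φ u) (φ v) φu≢φv (φ x)
                 ≡ cmap (φ u) (φ v) φu≢φv (φ (punchIn v (cmap u v u≢v x)))
cmap-natural φ u v u≢v φu≢φv x with v ≟ x
... | yes refl = trans (sym (cmap-identifies (φ u) (φ v) φu≢φv))
                       (cong (cmap (φ u) (φ v) φu≢φv ∘ φ) (sym (punchIn-punchOut _)))
... | no v≢x = cong (cmap (φ u) (φ v) φu≢φv ∘ φ) (sym (punchIn-punchOut v≢x))

record Embedding (S : SGraph) (H : ZGraph) : Set where
  field
    vertex : Fin (size S) → Fin (n H)
    vertex-injective : Injective _≡_ _≡_ vertex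
    adjacent : ∀ {a b} → Adj S a b → Adj (si H) (vertex a) (vertex b)

open Embedding

switched-embedding : ∀ {S H} (s : Fin (n H) → ℤ) → Embedding S H → Embedding S (switched H s)
switched-embedding s e = record
  { vertex = vertex e
  ; vertex-injective = vertex-injective e
  ; adjacent = λ Aab → let a≢b , γ , ab∈H = adjacent e Aab in a≢b , _ , ∈ᴱ-switched⁺ s ab∈H
  }

contracted-embedding :
  ∀ {m k} {A : Fin (suc m) → Fin (suc m) → Set} {sA : ∀ {a b} → A a b → A b a}
  {iA : ∀ {a} → ¬ A a a} {B : Fin m → Fin m → Set} {sB : ∀ {a b} → B a b → B b a}
  {iB : ∀ {a} → ¬ B a a} {E : List (Edge (suc k))} {sE : SimpleLab E}
  (e : Embedding (sg (suc m) A sA iA) (zg (suc k) E sE))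
  (u v : Fin (suc m)) (u≢v : u ≢ v) (U≢V : vertex e u ≢ vertex e v) →
  (∀ {a b} → B a b → a ≢ b × ∃[ x ] ∃[ y ]
     (cmap u v u≢v x ≡ a × cmap u v u≢v y ≡ b × A x y)) →
  Embedding (sg m B sB iB) (contracted (vertex e u) (vertex e v) U≢V E)
contracted-embedding {m} {k} {B = B} {E = E} e u v u≢v U≢V B⇒A = record
  { vertex = φ′
  ; vertex-injective = φ′-injective
  ; adjacent = adjacent′
  }
  where
  φ : Fin (suc m) → Fin (suc k)
  φ = vertex e

  U V : Fin (suc k)
  U = φ u
  V = φ v

  c : Fin (suc k) → Fin k
  c = cmap U V U≢V

  φ′ : Fin m → Fin k
  φ′ a = c (φ (punchIn v a))

  V≢φ′ : ∀ a → V ≢ φ (punchIn v a)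
  V≢φ′ a = punchInᵢ≢i v a ∘ sym ∘ vertex-injective e

  φ′-injective : Injective _≡_ _≡_ φ′
  φ′-injective {a} {b} =
    punchIn-injective v a b ∘ vertex-injective e ∘ cmap-injective U V U≢V (V≢φ′ a) (V≢φ′ b)

  adjacent′ : ∀ {a b} → B a b → Adj (si (contracted U V U≢V E)) (φ′ a) (φ′ b)
  adjacent′ Bab with B⇒A Bab
  ... | a≢b , x , y , refl , refl , Axy with adjacent e Axy
  ...   | _ , δ , xy∈E =
    a≢b ∘ φ′-injective , δ ,
    ∈ᴱ-contractedEdges⁺ U V U≢V E
      ( a≢b ∘ φ′-injective ∘ proj₁
      , (φ x , φ y , δ) , xy∈E , xy≉UV
      , cong₂ (λ p q → p , q , δ) (cmap-natural φ u v u≢v U≢V x) (cmap-natural φ u v u≢v U≢V y))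
    where
    xy≉UV : ¬ ((φ x , φ y , δ) ≈ₑ (U , V , + 0))
    xy≉UV (inj₁ eq)
      with vertex-injective e (cong proj₁ eq) | vertex-injective e (cong (proj₁ ∘ proj₂) eq)
    ... | refl | refl = a≢b (cmap-identifies u v u≢v)
    xy≉UV (inj₂ eq)
      with vertex-injective e (cong proj₁ eq) | vertex-injective e (cong (proj₁ ∘ proj₂) eq)
    ... | refl | refl = a≢b (sym (cmap-identifies u v u≢v))

switchAt : ∀ {n} → Fin n → ℤ → Fin n → ℤ
switchAt i γ j with i ≟ j
... | yes _ = γ
... | no _ = + 0

switchAt-zeroes : ∀ {n} {U V : Fin n} {γ} → U ≢ V →
                  switch (switchAt V γ) (U , V , γ) ≡ (U , V , + 0)
switchAt-zeroes {U = U} {V} {γ} U≢V with V ≟ U | V ≟ V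
... | yes V≡U | _ = ⊥-elim (U≢V (sym V≡U))
... | no _ | no V≢V = ⊥-elim (V≢V refl)
... | no _ | yes _ = cong (λ α → U , V , α) (lemma γ)
  where
  lemma : ∀ γ → γ + + 0 - γ ≡ + 0
  lemma = solve-∀

identity-embedding : ∀ G → Embedding (si G) G
identity-embedding G = record { vertex = id ; vertex-injective = id ; adjacent = id }

lift-step : ∀ {S T H} → SStep S T → Embedding S H → ∃[ H′ ] (ZMinor H H′ × Embedding T H′)
lift-step {T = T} (iso π S≅T) e = _ , ε , record
  { vertex = vertex e ∘ from
  ; vertex-injective = Injection.injective (↔⇒↣ (↔-sym π)) ∘ vertex-injective e
  ; adjacent = λ {a} {b} Tab → adjacent e (proj₂ (S≅T (from a) (from b))
      (subst₂ (Adj T) (sym (strictlyInverseˡ a)) (sym (strictlyInverseˡ b)) Tab))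
  }
  where open Inverse π
lift-step (sub ι ι-injective ι-adjacent) e = _ , ε , record
  { vertex = vertex e ∘ ι
  ; vertex-injective = ι-injective ∘ vertex-injective e
  ; adjacent = λ {a} {b} → adjacent e ∘ ι-adjacent a b
  }
lift-step {H = zg zero _ _} (contract u _ _ _ _) e with vertex e u
... | ()
lift-step {H = H@(zg (suc k) E sE)} (contract u v u≢v Auv contracts) e =
  _ , switching H s ◅ contraction U V U≢V UV₀∈E₁ ◅ ε ,
  contracted-embedding (switched-embedding s e) u v u≢v U≢V (proj₁ (contracts _ _))
  where
  U V : Fin (suc k)
  U = vertex e u
  V = vertex e v

  U≢V : U ≢ V
  U≢V = proj₁ (adjacent e Auv)

  γ : ℤ
  γ = proj₁ (proj₂ (adjacent e Auv))

  s : Fin (suc k) → ℤ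
  s = switchAt V γ

  UV₀∈E₁ : (U , V , + 0) ∈ᴱ map (switch s) E
  UV₀∈E₁ = subst (_∈ᴱ map (switch s) E) (switchAt-zeroes {γ = γ} U≢V)
                 (∈ᴱ-switched⁺ s (proj₂ (proj₂ (adjacent e Auv))))

lift-minor : ∀ {S T H} → SMinor S T → Embedding S H → ∃[ H′ ] (ZMinor H H′ × Embedding T H′)
lift-minor ε e = _ , ε , e
lift-minor (step ◅ steps) e =
  let H₁ , H⟶H₁ , e₁ = lift-step step e
      H₂ , H₁⟶H₂ , e₂ = lift-minor steps e₁
  in H₂ , H⟶H₁ ◅◅ H₁⟶H₂ , e₂

Skew : ∀ {k} → (Fin k → Fin k → ℤ) → Set
Skew ℓ = ∀ a b → ℓ b a ≡ - ℓ a b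

Balanced : ∀ {k} → (Fin k → Fin k → ℤ) → Fin k → Fin k → Fin k → Set
Balanced ℓ a b c = ℓ a b + ℓ b c + ℓ c a ≡ + 0

module _ {k} {ℓ : Fin k → Fin k → ℤ} where

  Balanced-rotate : ∀ {a b c} → Balanced ℓ a b c → Balanced ℓ b c a
  Balanced-rotate {a} {b} {c} abc = trans (lemma (ℓ a b) (ℓ b c) (ℓ c a)) abc
    where
    lemma : ∀ x y z → y + z + x ≡ x + y + z
    lemma = solve-∀

  Balanced-reverse : Skew ℓ → ∀ {a b c} → Balanced ℓ a b c → Balanced ℓ c b a
  Balanced-reverse skew {a} {b} {c} abc = begin
    ℓ c b + ℓ b a + ℓ a c          ≡⟨ cong₂ _+_ (cong₂ _+_ (skew b c) (skew a b)) (skew c a) ⟩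
    - ℓ b c + - ℓ a b + - ℓ c a    ≡⟨ lemma (ℓ a b) (ℓ b c) (ℓ c a) ⟩
    - (ℓ a b + ℓ b c + ℓ c a)      ≡⟨ cong -_ abc ⟩
    + 0                            ∎
    where
    lemma : ∀ x y z → - y + - x + - z ≡ - (x + y + z)
    lemma = solve-∀

  Balanced-apex : Skew ℓ → ∀ {a b c d} → Balanced ℓ a b c → Balanced ℓ a b d →
                  Balanced ℓ a c d → Balanced ℓ b c d
  Balanced-apex skew {a} {b} {c} {d} abc abd acd = begin
    ℓ b c + ℓ c d + ℓ d b
      ≡⟨ cong (_+_ (ℓ b c + ℓ c d)) (skew b d) ⟩
    ℓ b c + ℓ c d - ℓ b d
      ≡⟨ lemma (ℓ a b) (ℓ b c) (ℓ a c) (ℓ b d) (ℓ d a) (ℓ c d) ⟩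
    (ℓ a b + ℓ b c - ℓ a c) - (ℓ a b + ℓ b d + ℓ d a) + (ℓ a c + ℓ c d + ℓ d a)
      ≡⟨ cong₂ _+_ (cong₂ _-_ abc′ abd) acd ⟩
    + 0
      ∎
    where
    abc′ : ℓ a b + ℓ b c - ℓ a c ≡ + 0
    abc′ = trans (cong (_+_ (ℓ a b + ℓ b c)) (sym (skew a c))) abc
    lemma : ∀ ab bc ac bd da cd →
            bc + cd - bd ≡ (ab + bc - ac) - (ab + bd + da) + (ac + cd + da)
    lemma = solve-∀

  Balanced⇒potential : Skew ℓ → ∀ {a b c} → Balanced ℓ a b c → ℓ b c + ℓ a b - ℓ a c ≡ + 0
  Balanced⇒potential skew {a} {b} {c} abc = begin
    ℓ b c + ℓ a b - ℓ a c   ≡⟨ cong (_+_ (ℓ b c + ℓ a b)) (sym (skew a c)) ⟩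
    ℓ b c + ℓ a b + ℓ c a   ≡⟨ cong (_+ ℓ c a) (+-comm (ℓ b c) (ℓ a b)) ⟩
    ℓ a b + ℓ b c + ℓ c a   ≡⟨ abc ⟩
    + 0                     ∎

module _ (ℓ : Fin 4 → Fin 4 → ℤ) (skew : Skew ℓ) where

  private
    rot : ∀ {a b c} → Balanced ℓ a b c → Balanced ℓ b c a
    rot = Balanced-rotate {ℓ = ℓ}

    rev : ∀ {a b c} → Balanced ℓ a b c → Balanced ℓ c b a
    rev = Balanced-reverse skew

    apex : ∀ {a b c d} → Balanced ℓ a b c → Balanced ℓ a b d → Balanced ℓ a c d → Balanced ℓ b c d
    apex = Balanced-apex skew

    balanced? : ∀ a b c → Dec (Balanced ℓ a b c)
    balanced? a b c = ℓ a b + ℓ b c + ℓ c a ≟ℤ + 0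

  balanced-or-two-unbalanced :
    (Balanced ℓ 0F 1F 2F × Balanced ℓ 0F 1F 3F × Balanced ℓ 0F 2F 3F) ⊎
    Σ[ σ ∈ Permutation′ 4 ] (¬ Balanced ℓ (σ ⟨$⟩ʳ 0F) (σ ⟨$⟩ʳ 2F) (σ ⟨$⟩ʳ 3F) ×
                             ¬ Balanced ℓ (σ ⟨$⟩ʳ 1F) (σ ⟨$⟩ʳ 2F) (σ ⟨$⟩ʳ 3F))
  balanced-or-two-unbalanced
    with balanced? 0F 1F 2F | balanced? 0F 1F 3F | balanced? 0F 2F 3F
  ... | yes b₀₁₂ | yes b₀₁₃ | yes b₀₂₃ = inj₁ (b₀₁₂ , b₀₁₃ , b₀₂₃)
  ... | no ¬b₀₁₂ | no ¬b₀₁₃ | _ =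
    inj₂ (transpose 0F 2F ∘ₚ transpose 1F 3F , ¬b₀₁₂ ∘ rot , ¬b₀₁₃ ∘ rot)
  ... | no ¬b₀₁₂ | yes _ | no ¬b₀₂₃ =
    inj₂ (transpose 0F 3F , ¬b₀₂₃ ∘ rev , ¬b₀₁₂ ∘ rot ∘ rot)
  ... | yes _ | no ¬b₀₁₃ | no ¬b₀₂₃ =
    inj₂ (transpose 0F 2F , ¬b₀₂₃ ∘ rot ∘ rev , ¬b₀₁₃ ∘ rot ∘ rev)
  ... | no ¬b₀₁₂ | yes b₀₁₃ | yes b₀₂₃ =
    inj₂ (transpose 1F 3F , ¬b₀₁₂ ∘ rot ∘ rot ∘ rev ,
          λ b₃₂₁ → ¬b₀₁₂ (apex (rot (rot b₀₁₃)) (rot (rot b₀₂₃)) (rot (rot (rev b₃₂₁)))))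
  ... | yes b₀₁₂ | no ¬b₀₁₃ | yes b₀₂₃ =
    inj₂ (transpose 1F 2F , ¬b₀₁₃ , λ b₂₁₃ → ¬b₀₁₃ (apex (rot (rot b₀₁₂)) (rot (rev b₀₂₃)) b₂₁₃))
  ... | yes b₀₁₂ | yes b₀₁₃ | no ¬b₀₂₃ =
    inj₂ (Perm.id , ¬b₀₂₃ , λ b₁₂₃ → ¬b₀₂₃ (apex (rot (rev b₀₁₂)) (rot (rev b₀₁₃)) b₁₂₃))

record Frame (k : ℕ) (H : ZGraph) : Set where
  field
    corner : Fin k → Fin (n H)
    corner-injective : Injective _≡_ _≡_ corner
    label : Fin k → Fin k → ℤ
    label-skew : Skew label
    side : ∀ {a b} → a ≢ b → (corner a , corner b , label a b) ∈ᴱ edges H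

open Frame

complete-frame : ∀ {k H} (φ : Fin k → Fin (n H)) → Injective _≡_ _≡_ φ →
                 (∀ {a b} → a ≢ b → Adj (si H) (φ a) (φ b)) → Frame k H
complete-frame {k} {H} φ φ-injective adjacent = record
  { corner = φ
  ; corner-injective = φ-injective
  ; label = ℓ
  ; label-skew = ℓ-skew
  ; side = ℓ-side
  }
  where
  γ : ∀ {a b} → a < b → ℤ
  γ a<b = proj₁ (proj₂ (adjacent (<⇒≢ a<b)))

  ℓ : Fin k → Fin k → ℤ
  ℓ a b with <-cmp a b
  ... | tri< a<b _ _ = γ a<b
  ... | tri≈ _ _ _ = + 0
  ... | tri> _ _ b<a = - γ b<a

  ℓ-skew : Skew ℓ
  ℓ-skew a b with <-cmp a b | <-cmp b a
  ... | tri< a<b _ _ | tri> _ _ a<b′ = cong (-_ ∘ γ) (<-irrelevant a<b′ a<b)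
  ... | tri> _ _ b<a | tri< b<a′ _ _ = trans (cong γ (<-irrelevant b<a′ b<a)) (sym (neg-involutive _))
  ... | tri≈ _ _ _ | tri≈ _ _ _ = refl
  ... | tri< _ _ ¬b<a | tri< b<a _ _ = ⊥-elim (¬b<a b<a)
  ... | tri< _ a≢b _ | tri≈ _ b≡a _ = ⊥-elim (a≢b (sym b≡a))
  ... | tri≈ _ a≡b _ | tri< _ b≢a _ = ⊥-elim (b≢a (sym a≡b))
  ... | tri≈ _ a≡b _ | tri> _ b≢a _ = ⊥-elim (b≢a (sym a≡b))
  ... | tri> _ a≢b _ | tri≈ _ b≡a _ = ⊥-elim (a≢b (sym b≡a))
  ... | tri> ¬a<b _ _ | tri> _ _ a<b = ⊥-elim (¬a<b a<b)

  ℓ-side : ∀ {a b} → a ≢ b → (φ a , φ b , ℓ a b) ∈ᴱ edges H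
  ℓ-side {a} {b} a≢b with <-cmp a b
  ... | tri< a<b _ _ = proj₂ (proj₂ (adjacent (<⇒≢ a<b)))
  ... | tri≈ _ a≡b _ = ⊥-elim (a≢b a≡b)
  ... | tri> _ _ b<a = ∈ᴱ-inv (proj₂ (proj₂ (adjacent (<⇒≢ b<a))))

permuted-frame : ∀ {k H} → Frame k H → Permutation′ k → Frame k H
permuted-frame F σ = record
  { corner = corner F ∘ (σ ⟨$⟩ʳ_)
  ; corner-injective = σ-injective ∘ corner-injective F
  ; label = λ a b → label F (σ ⟨$⟩ʳ a) (σ ⟨$⟩ʳ b)
  ; label-skew = λ a b → label-skew F (σ ⟨$⟩ʳ a) (σ ⟨$⟩ʳ b)
  ; side = λ a≢b → side F (a≢b ∘ σ-injective)
  }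
  where
  σ-injective : Injective _≡_ _≡_ (σ ⟨$⟩ʳ_)
  σ-injective = Injection.injective (↔⇒↣ σ)

labelledK4 : (Fin 4 → Fin 4 → ℤ) → ZGraph
labelledK4 ℓ = zg 4 sides
  ( (λ ()) ∷ (λ ()) ∷ (λ ()) ∷ (λ ()) ∷ (λ ()) ∷ (λ ()) ∷ []
  , toWitness {a? = AllPairs.allPairs? (λ e f → ¬? (e ≈ₑ? f)) sides} _)
  where
  sides : List (Edge 4)
  sides = (0F , 1F , ℓ 0F 1F) ∷ (0F , 2F , ℓ 0F 2F) ∷ (0F , 3F , ℓ 0F 3F)
        ∷ (1F , 2F , ℓ 1F 2F) ∷ (1F , 3F , ℓ 1F 3F) ∷ (2F , 3F , ℓ 2F 3F) ∷ []

restriction : ∀ {H} (F : Frame 4 H) → ZStep H (labelledK4 (label F))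
restriction {H} F = deletion H (labelledK4 (label F)) (corner F) (corner-injective F)
  ( side F (λ ()) ∷ side F (λ ()) ∷ side F (λ ())
  ∷ side F (λ ()) ∷ side F (λ ()) ∷ side F (λ ()) ∷ [])

zero-label : ∀ {k} {a b : Fin k} {γ} → γ ≡ + 0 → (a , b , + 0) ≈ₑ (a , b , γ)
zero-label γ≡0 = inj₁ (cong (λ γ → _ , _ , γ) (sym γ≡0))

-- Switching by ℓ(0, ·) turns the label of each side ij into the balance of triangle 0ij.
balanced-K4 : ∀ {ℓ} → Skew ℓ → Balanced ℓ 0F 1F 2F → Balanced ℓ 0F 1F 3F → Balanced ℓ 0F 2F 3F →
              ZMinor (labelledK4 ℓ) K4₀
balanced-K4 {ℓ} skew b₀₁₂ b₀₁₃ b₀₂₃ =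
  switching (labelledK4 ℓ) potential ◅
  deletion _ K4₀ id id
    ( here (zero-label (cancel (ℓ 0F 1F)))
    ∷ there (here (zero-label (cancel (ℓ 0F 2F))))
    ∷ there (there (here (zero-label (cancel (ℓ 0F 3F)))))
    ∷ there (there (there (here (zero-label (Balanced⇒potential skew b₀₁₂)))))
    ∷ there (there (there (there (here (zero-label (Balanced⇒potential skew b₀₁₃))))))
    ∷ there (there (there (there (there (here (zero-label (Balanced⇒potential skew b₀₂₃)))))))
    ∷ []) ◅ ε
  where
  potential : Fin 4 → ℤ
  potential 0F = + 0
  potential i = ℓ 0F i
  cancel : ∀ x → x + + 0 - x ≡ + 0
  cancel = solve-∀

HasK3••Minor : ZGraph → Set
HasK3••Minor H =
  ∃[ a ] ∃[ b ] ∃[ c ] ∃[ d ] ∃[ e ]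
  Σ[ w ∈ SimpleLab (K3••edges a b c d e) ] ZMinor H (zg 3 (K3••edges a b c d e) w)

parallel-edges-differ : ∀ {k} {x y : Fin k} {α β} → x ≢ y → α ≢ β → ¬ ((x , y , α) ≈ₑ (x , y , β))
parallel-edges-differ x≢y α≢β (inj₁ eq) = α≢β (cong (proj₂ ∘ proj₂) eq)
parallel-edges-differ x≢y α≢β (inj₂ eq) = x≢y (cong proj₁ eq)

K3••-simple : ∀ {a b c d e} → b ≢ c → d ≢ e → SimpleLab (K3••edges a b c d e)
K3••-simple b≢c d≢e =
  ((λ ()) ∷ (λ ()) ∷ (λ ()) ∷ (λ ()) ∷ (λ ()) ∷ [])
  , ( ((λ { (inj₁ ()) ; (inj₂ ()) }) ∷ (λ { (inj₁ ()) ; (inj₂ ()) })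
       ∷ (λ { (inj₁ ()) ; (inj₂ ()) }) ∷ (λ { (inj₁ ()) ; (inj₂ ()) }) ∷ [])
    ∷ (parallel-edges-differ (λ ()) b≢c
       ∷ (λ { (inj₁ ()) ; (inj₂ ()) }) ∷ (λ { (inj₁ ()) ; (inj₂ ()) }) ∷ [])
    ∷ ((λ { (inj₁ ()) ; (inj₂ ()) }) ∷ (λ { (inj₁ ()) ; (inj₂ ()) }) ∷ [])
    ∷ (parallel-edges-differ (λ ()) d≢e ∷ [])
    ∷ [] ∷ [])

-- Switching 3 by ℓ(2,3) and contracting 23 leaves, from each a ∈ {0,1}, two parallel edges
-- with labels ℓ(a,2) and ℓ(a,3) - ℓ(2,3); they differ because triangle a23 is unbalanced.
unbalanced-K3•• : ∀ {ℓ} → Skew ℓ → ¬ Balanced ℓ 0F 2F 3F → ¬ Balanced ℓ 1F 2F 3F →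
                  HasK3••Minor (labelledK4 ℓ)
unbalanced-K3•• {ℓ} skew ¬b₀₂₃ ¬b₁₂₃ =
  _ , _ , _ , _ , _ , K3••-simple (split-labels-differ ¬b₀₂₃) (split-labels-differ ¬b₁₂₃) ,
  switching (labelledK4 ℓ) potential ◅ contraction 2F 3F 2≢3 23∈E₁ ◅
  deletion _ (zg 3 _ _) id id (kept (here ≈ₑ-refl) ∷ kept (there (here ≈ₑ-refl))
    ∷ kept (there (there (here ≈ₑ-refl))) ∷ kept (there (there (there (here ≈ₑ-refl))))
    ∷ kept (there (there (there (there (here ≈ₑ-refl))))) ∷ []) ◅ ε
  where
  2≢3 : 2F ≢ 3F
  2≢3 ()

  potential : Fin 4 → ℤ
  potential 3F = ℓ 2F 3F
  potential _ = + 0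

  E₁ : List (Edge 4)
  E₁ = edges (switched (labelledK4 ℓ) potential)

  23∈E₁ : (2F , 3F , + 0) ∈ᴱ E₁
  23∈E₁ = there (there (there (there (there (here (zero-label (lemma (ℓ 2F 3F))))))))
    where
    lemma : ∀ x → x + + 0 - x ≡ + 0
    lemma = solve-∀

  kept : ∀ {e} → e ∈ᴱ E₁ →
         {_ : False (isZeroLoop? (mapV (cmap 2F 3F 2≢3) e))} {_ : False (e ≈ₑ? (2F , 3F , + 0))} →
         mapV (cmap 2F 3F 2≢3) e ∈ᴱ contractedEdges 2F 3F 2≢3 E₁
  kept e∈E₁ {nz} {e≉23} =
    ∈ᴱ-contractedEdges⁺ 2F 3F 2≢3 E₁ (toWitnessFalse nz , _ , e∈E₁ , toWitnessFalse e≉23 , refl)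

  split-labels-differ : ∀ {a} → ¬ Balanced ℓ a 2F 3F →
                        ℓ a 2F + + 0 - + 0 ≢ ℓ a 3F + + 0 - ℓ 2F 3F
  split-labels-differ {a} ¬b eq = ¬b (begin
    ℓ a 2F + ℓ 2F 3F + ℓ 3F a
      ≡⟨ cong (_+_ (ℓ a 2F + ℓ 2F 3F)) (skew a 3F) ⟩
    ℓ a 2F + ℓ 2F 3F - ℓ a 3F
      ≡⟨ lemma (ℓ a 2F) (ℓ a 3F) (ℓ 2F 3F) ⟩
    (ℓ a 2F + + 0 - + 0) - (ℓ a 3F + + 0 - ℓ 2F 3F)
      ≡⟨ cong (_- (ℓ a 3F + + 0 - ℓ 2F 3F)) eq ⟩
    (ℓ a 3F + + 0 - ℓ 2F 3F) - (ℓ a 3F + + 0 - ℓ 2F 3F)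
      ≡⟨ +-inverseʳ (ℓ a 3F + + 0 - ℓ 2F 3F) ⟩
    + 0 ∎)
    where
    lemma : ∀ x y z → x + z - y ≡ (x + + 0 - + 0) - (y + + 0 - z)
    lemma = solve-∀

frame-minor : ∀ {H} → Frame 4 H → ZMinor H K4₀ ⊎ HasK3••Minor H
frame-minor F with balanced-or-two-unbalanced (label F) (label-skew F)
... | inj₁ (b₀₁₂ , b₀₁₃ , b₀₂₃) = inj₁ (restriction F ◅ balanced-K4 (label-skew F) b₀₁₂ b₀₁₃ b₀₂₃)
... | inj₂ (σ , ¬b₀₂₃ , ¬b₁₂₃) =
  let a , b , c , d , e , w , K4ℓ⟶K3•• = unbalanced-K3•• (label-skew (permuted-frame F σ)) ¬b₀₂₃ ¬b₁₂₃
  in inj₂ (a , b , c , d , e , w , restriction (permuted-frame F σ) ◅ K4ℓ⟶K3••)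

lemma7p4 : (G : ZGraph) →
    ¬ ZMinor G K4₀ →
    (∀ (a b c d e : ℤ) (w : SimpleLab (K3••edges a b c d e)) →
      ¬ ZMinor G (zg 3 (K3••edges a b c d e) w)) →
    ¬ SMinor (si G) K4
lemma7p4 G noK4₀ noK3•• K4≼siG
  with H , G⟶H , K4↪H ← lift-minor K4≼siG (identity-embedding G)
  with frame-minor (complete-frame (vertex K4↪H) (vertex-injective K4↪H) (adjacent K4↪H))
... | inj₁ H⟶K4₀ = noK4₀ (G⟶H ◅◅ H⟶K4₀)
... | inj₂ (a , b , c , d , e , w , H⟶K3••) = noK3•• a b c d e w (G⟶H ◅◅ H⟶K3••)
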